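{- Let $(G,l,c,B)$ be an instance of (2-SPNI) where $G$ is a two-terminal series-parallel graph with source $s$ and sink $t$, and let $T_G$ be a decomposition tree of $G$. Define, for every graph $H$ in $T_G$ and every $x\in\{0,1,\dots,B\}$, a set $\mathcal{L}(H,x)\subseteq(\mathbb{N}\cup\{\infty\})^2$ bottom-up as follows. If $H$ is a leaf with single arc $a^*$: if $c(a^*)\leq B$ then $\mathcal{L}(H,x)=\{(l^1(a^*),l^2(a^*))\}$ for $x=0,\dots,c(a^*)-1$ and $\mathcal{L}(H,x)=\{(\infty,\infty)\}$ for $x=c(a^*),\dots,B$; if $c(a^*)>B$ then $\mathcal{L}(H,x)=\{(l^1(a^*),l^2(a^*))\}$ for all $x$. If $H$ is the parallel composition of $H_1$ and $H_2$, then $\mathcal{L}(H,x)=\max\left\{\bigcup_{k=0}^{x}\mathcal{L}(H_1,k)\odot\mathcal{L}(H_2,x-k)\right\}$. If $H$ is the series composition of $H_1$ and $H_2$, then $\mathcal{L}(H,x)=\max\left\{\bigcup_{k=0}^{x}\mathcal{L}(H_1,k)\oplus\mathcal{L}(H_2,x-k)\right\}$. Then $\mathcal{L}(G,B)$ is the set $Z_N$ of non-dominated points of the instance $(G,l,c,B)$.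
   Context: (2-SPNI) instance $(G,l,c,B)$: directed network $G=(V,A)$ (parallel arcs allowed) with source $s$, sink $t$, lengths $l=(l^1,l^2):A\to\mathbb{N}^2$, costs $c:A\to\mathbb{N}$, budget $B\in\mathbb{N}$. Feasible strategies $\Gamma=\{\gamma\in\{0,1\}^A:\sum_a c(a)\gamma_a\leq B\}$; $G(\gamma)$ is $G$ with arcs $a$ having $\gamma_a=1$ removed; $f_G(\gamma)=(f^1_G(\gamma),f^2_G(\gamma))$ with $f^i_G(\gamma)$ the minimum $l^i$-length of an $s$-$t$-path in $G(\gamma)$ ($\infty$ if none). Pareto order: $y_1\geq y_2$ iff $y_1^k\geq y_2^k$ for $k=1,2$ and $y_1\neq y_2$ (with $\infty$ larger than every integer). $\gamma\in\Gamma$ is efficient if no $\gamma'\in\Gamma$ has $f_G(\gamma')\geq f_G(\gamma)$; $Z_N$ is the set of $f_G(\gamma)$ for efficient $\gamma$. Two-terminal series-parallel graphs are built from single-arc graphs $(s,t)$ by parallel composition (identify the two sources and the two sinks) and series composition (identify the sink of the first with the source of the second; the new source is the first's source, the new sink the second's sink). A decomposition tree $T_G$ is a rooted binary tree whose nodes are graphs: the root is $G$, leaves are single-arc (primitive) subgraphs corresponding to the arcs of $G$, and each internal node is the parallel or series composition of its two children (with the same lengths and costs restricted to its arcs). For sets $S,T$: $S\oplus T=\{a+b:a\in S,b\in T\}$ (with $\infty+z=\infty$), $S\odot T=\{(\min\{a^1,b^1\},\min\{a^2,b^2\}):a\in S,b\in T\}$, and $\max\{S\}$ is the set of elements of $S$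 not dominated (in the Pareto order) by another element of $S$. -}

module Defs where

open import Data.Nat using (ℕ; zero; suc; _+_; _∸_; _≤_; _<_; _≤?_; _<?_)
open import Data.Nat.Properties using () renaming (_≟_ to _≟ℕ_)
open import Data.Bool using (Bool; true; false; if_then_else_)
open import Data.Unit using (⊤; tt)
open import Data.Empty using (⊥)
open import Data.Sum using (_⊎_; inj₁; inj₂)
open import Data.Product using (Σ; _×_; _,_; proj₁; proj₂; ∃)
open import Data.List using (List; []; _∷_; concatMap; filter; upTo)
open import Data.List.Relation.Unary.Any using (any?)
open import Relation.Nullary using (¬_; Dec; yes; no; ¬?)
open import Relation.Nullary.Decidable using (_×-dec_)
open import Relation.Binary.PropositionalEquality using (_≡_; refl; cong)

data ℕ∞ : Set where
  fin : ℕ → ℕ∞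
  ∞   : ℕ∞

data _≤∞_ : ℕ∞ → ℕ∞ → Set where
  fin≤fin : ∀ {m n} → m ≤ n → fin m ≤∞ fin n
  _≤∞∞    : ∀ x → x ≤∞ ∞

_≤∞?_ : (x y : ℕ∞) → Dec (x ≤∞ y)
fin m ≤∞? fin n with m ≤? n
... | yes p = yes (fin≤fin p)
... | no ¬p = no λ { (fin≤fin q) → ¬p q }
fin m ≤∞? ∞ = yes (fin m ≤∞∞)
∞ ≤∞? fin n = no λ ()
∞ ≤∞? ∞ = yes (∞ ≤∞∞)

_≟∞_ : (x y : ℕ∞) → Dec (x ≡ y)
fin m ≟∞ fin n with m ≟ℕ n
... | yes refl = yes refl
... | no ¬p = no λ { refl → ¬p refl }
fin m ≟∞ ∞ = no λ ()
∞ ≟∞ fin n = no λ ()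
∞ ≟∞ ∞ = yes refl

min∞ : ℕ∞ → ℕ∞ → ℕ∞
min∞ (fin m) (fin n) = fin (Data.Nat._⊓_ m n)
min∞ (fin m) ∞ = fin m
min∞ ∞ y = y

_+∞_ : ℕ∞ → ℕ∞ → ℕ∞
fin m +∞ fin n = fin (m + n)
fin m +∞ ∞ = ∞
∞ +∞ y = ∞

Point : Set
Point = ℕ∞ × ℕ∞

_≟P_ : (y z : Point) → Dec (y ≡ z)
(a , b) ≟P (c , d) with a ≟∞ c | b ≟∞ d
... | yes refl | yes refl = yes refl
... | no ¬p | _ = no λ { refl → ¬p refl }
... | yes _ | no ¬q = no λ { refl → ¬q refl }

_≥P_ : Point → Point → Set
y ≥P z = (proj₁ z ≤∞ proj₁ y) × (proj₂ z ≤∞ proj₂ y) × ¬ (y ≡ z)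

_≥P?_ : (y z : Point) → Dec (y ≥P z)
y ≥P? z = (proj₁ z ≤∞? proj₁ y) ×-dec ((proj₂ z ≤∞? proj₂ y) ×-dec ¬? (y ≟P z))

_⊕_ : List Point → List Point → List Point
S ⊕ T = concatMap (λ a → concatMap (λ b → (proj₁ a +∞ proj₁ b , proj₂ a +∞ proj₂ b) ∷ []) T) S

_⊙_ : List Point → List Point → List Point
S ⊙ T = concatMap (λ a → concatMap (λ b → (min∞ (proj₁ a) (proj₁ b) , min∞ (proj₂ a) (proj₂ b)) ∷ []) T) S

maxP : List Point → List Point
maxP S = filter (λ y → ¬? (any? (λ z → z ≥P? y) S)) S

-- Two-terminal series-parallel graphs, given by their decomposition tree

data SP : Set where
  leaf : SP
  par  : SP → SP → SP
  ser  : SP → SP → SP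

Arc : SP → Set
Arc leaf = ⊤
Arc (par T₁ T₂) = Arc T₁ ⊎ Arc T₂
Arc (ser T₁ T₂) = Arc T₁ ⊎ Arc T₂

-- non-terminal vertices; a series composition creates one new inner vertex
-- (the identified sink of the first / source of the second graph)
Inner : SP → Set
Inner leaf = ⊥
Inner (par T₁ T₂) = Inner T₁ ⊎ Inner T₂
Inner (ser T₁ T₂) = Inner T₁ ⊎ (Inner T₂ ⊎ ⊤)

data Vert (T : SP) : Set where
  src   : Vert T
  snk   : Vert T
  inner : Inner T → Vert T

embP₁ : ∀ {T₁ T₂} → Vert T₁ → Vert (par T₁ T₂)
embP₁ src = src
embP₁ snk = snk
embP₁ (inner i) = inner (inj₁ i)

embP₂ : ∀ {T₁ T₂} → Vert T₂ → Vert (par T₁ T₂)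
embP₂ src = src
embP₂ snk = snk
embP₂ (inner i) = inner (inj₂ i)

embS₁ : ∀ {T₁ T₂} → Vert T₁ → Vert (ser T₁ T₂)
embS₁ src = src
embS₁ snk = inner (inj₂ (inj₂ tt))
embS₁ (inner i) = inner (inj₁ i)

embS₂ : ∀ {T₁ T₂} → Vert T₂ → Vert (ser T₁ T₂)
embS₂ src = inner (inj₂ (inj₂ tt))
embS₂ snk = snk
embS₂ (inner i) = inner (inj₂ (inj₁ i))

tl : (T : SP) → Arc T → Vert T
tl leaf _ = src
tl (par T₁ T₂) (inj₁ a) = embP₁ (tl T₁ a)
tl (par T₁ T₂) (inj₂ a) = embP₂ (tl T₂ a)
tl (ser T₁ T₂) (inj₁ a) = embS₁ (tl T₁ a)
tl (ser T₁ T₂) (inj₂ a) = embS₂ (tl T₂ a)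

hd : (T : SP) → Arc T → Vert T
hd leaf _ = snk
hd (par T₁ T₂) (inj₁ a) = embP₁ (hd T₁ a)
hd (par T₁ T₂) (inj₂ a) = embP₂ (hd T₂ a)
hd (ser T₁ T₂) (inj₁ a) = embS₁ (hd T₁ a)
hd (ser T₁ T₂) (inj₂ a) = embS₂ (hd T₂ a)

Strategy : SP → Set
Strategy T = Arc T → Bool   -- γ a = true  means γ_a = 1 (arc removed)

cost : (T : SP) → (Arc T → ℕ) → Strategy T → ℕ
cost leaf c γ = if γ tt then c tt else 0
cost (par T₁ T₂) c γ = cost T₁ (λ a → c (inj₁ a)) (λ a → γ (inj₁ a))
                     + cost T₂ (λ a → c (inj₂ a)) (λ a → γ (inj₂ a))
cost (ser T₁ T₂) c γ = cost T₁ (λ a → c (inj₁ a)) (λ a → γ (inj₁ a))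
                     + cost T₂ (λ a → c (inj₂ a)) (λ a → γ (inj₂ a))

Feasible : (T : SP) → (Arc T → ℕ) → ℕ → Strategy T → Set
Feasible T c B γ = cost T c γ ≤ B

-- Walk T γ w u v n : a u-v path in G(γ) of w-length n
-- (the graph is acyclic, so walks are paths)
data Walk (T : SP) (γ : Strategy T) (w : Arc T → ℕ) : Vert T → Vert T → ℕ → Set where
  stop : ∀ {v} → Walk T γ w v v 0
  step : ∀ {u v n} (a : Arc T) → γ a ≡ false → tl T a ≡ u →
         Walk T γ w (hd T a) v n → Walk T γ w u v (w a + n)

ShortestIs : (T : SP) → Strategy T → (Arc T → ℕ) → ℕ∞ → Set
ShortestIs T γ w ∞ = ∀ n → ¬ Walk T γ w src snk n
ShortestIs T γ w (fin n) = Walk T γ w src snk n × (∀ m → Walk T γ w src snk m → n ≤ m)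

ObjIs : (T : SP) → (l₁ l₂ : Arc T → ℕ) → Strategy T → Point → Set
ObjIs T l₁ l₂ γ y = ShortestIs T γ l₁ (proj₁ y) × ShortestIs T γ l₂ (proj₂ y)

Efficient : (T : SP) → (l₁ l₂ c : Arc T → ℕ) → ℕ → Strategy T → Set
Efficient T l₁ l₂ c B γ =
  ∀ (γ' : Strategy T) → Feasible T c B γ' →
  ∀ y y' → ObjIs T l₁ l₂ γ y → ObjIs T l₁ l₂ γ' y' → ¬ (y' ≥P y)

InZN : (T : SP) → (l₁ l₂ c : Arc T → ℕ) → ℕ → Point → Set
InZN T l₁ l₂ c B y =
  Σ (Strategy T) λ γ → Feasible T c B γ × Efficient T l₁ l₂ c B γ × ObjIs T l₁ l₂ γ y

unionOver : ℕ → (ℕ → List Point) → List Point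
unionOver x F = concatMap F (upTo (suc x))

L : (T : SP) → (l₁ l₂ c : Arc T → ℕ) → (B x : ℕ) → List Point
L leaf l₁ l₂ c B x with c tt ≤? B
... | no _ = (fin (l₁ tt) , fin (l₂ tt)) ∷ []
... | yes _ with x <? c tt
...   | yes _ = (fin (l₁ tt) , fin (l₂ tt)) ∷ []
...   | no _  = (∞ , ∞) ∷ []
L (par T₁ T₂) l₁ l₂ c B x =
  maxP (unionOver x λ k →
    L T₁ (λ a → l₁ (inj₁ a)) (λ a → l₂ (inj₁ a)) (λ a → c (inj₁ a)) B k
    ⊙ L T₂ (λ a → l₁ (inj₂ a)) (λ a → l₂ (inj₂ a)) (λ a → c (inj₂ a)) B (x ∸ k))
L (ser T₁ T₂) l₁ l₂ c B x =
  maxP (unionOver x λ k →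
    L T₁ (λ a → l₁ (inj₁ a)) (λ a → l₂ (inj₁ a)) (λ a → c (inj₁ a)) B k
    ⊕ L T₂ (λ a → l₁ (inj₂ a)) (λ a → l₂ (inj₂ a)) (λ a → c (inj₂ a)) B (x ∸ k))

module Submission where

open import Defs
open import Data.Nat using (ℕ; suc; _+_; _∸_; _≤_; _<_; _⊓_; z≤n; s≤s; _≤?_; _<?_)
open import Data.Nat.Properties
open import Data.Nat.Induction using (<-wellFounded)
open import Data.Bool using (true; false)
open import Data.Unit using (tt)
open import Data.Empty using (⊥-elim)
open import Data.Sum using (_⊎_; inj₁; inj₂; [_,_])
open import Data.Product using (Σ; _×_; _,_; proj₁; proj₂)
open import Data.List using (List; []; _∷_; concatMap; filter; upTo; length)
open import Data.List.Relation.Unary.Any using (Any; here; there; any?)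
open import Data.List.Membership.Propositional using (_∈_; find; lose)
open import Data.List.Membership.Propositional.Properties
  using (∈-concatMap⁺; ∈-concatMap⁻; ∈-filter⁺; ∈-filter⁻; ∈-upTo⁺; ∈-upTo⁻)
open import Function.Base using (_∘_)
open import Function.Bundles using (_⇔_; mk⇔)
open import Induction.WellFounded using (Acc; acc)
open import Relation.Nullary using (¬_; yes; no; ¬?)
open import Relation.Unary using (Decidable)
open import Relation.Binary.PropositionalEquality
  using (_≡_; refl; sym; trans; cong; cong₂; subst; subst₂)

-- By induction on the decomposition tree, for x ≤ B the set L(H, x) consists exactly of
-- the maximal points among the values f_H(γ) of the strategies γ of cost at most x.
-- In a series-parallel graph an s-t path of a parallel composition lies in one of the
-- two parts and one of a series composition is a path of the first part followed by a
-- path of the second, so f_H(γ) is the componentwise min (resp. sum) of the values of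
-- the restrictions of γ; both operations are monotone for the Pareto order, which lets
-- maximal points be computed from maximal points of the parts.

≤∞-refl : ∀ x → x ≤∞ x
≤∞-refl (fin n) = fin≤fin ≤-refl
≤∞-refl ∞ = ∞ ≤∞∞

≤∞-trans : ∀ {x y z} → x ≤∞ y → y ≤∞ z → x ≤∞ z
≤∞-trans (fin≤fin p) (fin≤fin q) = fin≤fin (≤-trans p q)
≤∞-trans {x} _ (_ ≤∞∞) = x ≤∞∞

≤∞-antisym : ∀ {x y} → x ≤∞ y → y ≤∞ x → x ≡ y
≤∞-antisym (fin≤fin p) (fin≤fin q) = cong fin (≤-antisym p q)
≤∞-antisym (.∞ ≤∞∞) (.∞ ≤∞∞) = refl

min∞-mono : ∀ {a a' b b'} → a ≤∞ a' → b ≤∞ b' → min∞ a b ≤∞ min∞ a' b'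
min∞-mono (fin≤fin p) (fin≤fin q) = fin≤fin (⊓-mono-≤ p q)
min∞-mono {a} {b = b} (_ ≤∞∞) (_ ≤∞∞) = min∞ a b ≤∞∞
min∞-mono {fin m} (_ ≤∞∞) (fin≤fin q) = fin≤fin (≤-trans (m⊓n≤n m _) q)
min∞-mono {∞} (_ ≤∞∞) (fin≤fin q) = fin≤fin q
min∞-mono {b = fin n} (fin≤fin {m} p) (_ ≤∞∞) = fin≤fin (≤-trans (m⊓n≤m m n) p)
min∞-mono {b = ∞} (fin≤fin p) (_ ≤∞∞) = fin≤fin p

+∞-mono : ∀ {a a' b b'} → a ≤∞ a' → b ≤∞ b' → (a +∞ b) ≤∞ (a' +∞ b')
+∞-mono (fin≤fin p) (fin≤fin q) = fin≤fin (+-mono-≤ p q)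
+∞-mono {a} {b = b} (_ ≤∞∞) _ = (a +∞ b) ≤∞∞
+∞-mono {a} {fin _} {b} (fin≤fin _) (_ ≤∞∞) = (a +∞ b) ≤∞∞

_⊒_ : Point → Point → Set
y ⊒ z = (proj₁ z ≤∞ proj₁ y) × (proj₂ z ≤∞ proj₂ y)

⊒-refl : ∀ y → y ⊒ y
⊒-refl (a , b) = ≤∞-refl a , ≤∞-refl b

⊒-trans : ∀ {x y z} → x ⊒ y → y ⊒ z → x ⊒ z
⊒-trans (p , q) (r , s) = ≤∞-trans r p , ≤∞-trans s q

≥P⇒⊒ : ∀ {y z} → y ≥P z → y ⊒ z
≥P⇒⊒ (p , q , _) = p , q

⊒-≥P-trans : ∀ {x y z} → x ⊒ y → y ≥P z → x ≥P z
⊒-≥P-trans (p , q) (r , s , y≢z) =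
  ≤∞-trans r p , ≤∞-trans s q , λ { refl → y≢z (cong₂ _,_ (≤∞-antisym p r) (≤∞-antisym q s)) }

≥P-irrefl : ∀ {y} → ¬ (y ≥P y)
≥P-irrefl (_ , _ , y≢y) = y≢y refl

_∧ᴾ_ _+ᴾ_ : Point → Point → Point
a ∧ᴾ b = min∞ (proj₁ a) (proj₁ b) , min∞ (proj₂ a) (proj₂ b)
a +ᴾ b = (proj₁ a +∞ proj₁ b) , (proj₂ a +∞ proj₂ b)

∧ᴾ-mono : ∀ {a a' b b'} → a' ⊒ a → b' ⊒ b → (a' ∧ᴾ b') ⊒ (a ∧ᴾ b)
∧ᴾ-mono (p , q) (r , s) = min∞-mono p r , min∞-mono q s

+ᴾ-mono : ∀ {a a' b b'} → a' ⊒ a → b' ⊒ b → (a' +ᴾ b') ⊒ (a +ᴾ b)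
+ᴾ-mono (p , q) (r , s) = +∞-mono p r , +∞-mono q s

undominated? : (S : List Point) → Decidable (λ y → ¬ Any (_≥P y) S)
undominated? S y = ¬? (any? (_≥P? y) S)

maxP⊆ : ∀ {S y} → y ∈ maxP S → y ∈ S
maxP⊆ {S} y∈ = proj₁ (∈-filter⁻ (undominated? S) {xs = S} y∈)

maxP-antichain : ∀ {S y z} → y ∈ maxP S → z ∈ maxP S → ¬ (z ≥P y)
maxP-antichain {S} y∈ z∈ z>y =
  proj₂ (∈-filter⁻ (undominated? S) {xs = S} y∈) (lose (maxP⊆ {S} z∈) z>y)

length-filter-mono : ∀ {A : Set} {P Q : A → Set} (P? : Decidable P) (Q? : Decidable Q) →
                     (∀ {u} → P u → Q u) → ∀ xs → length (filter P? xs) ≤ length (filter Q? xs)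
length-filter-mono P? Q? P⇒Q [] = z≤n
length-filter-mono P? Q? P⇒Q (x ∷ xs) with P? x | Q? x
... | yes _ | yes _  = s≤s (length-filter-mono P? Q? P⇒Q xs)
... | yes p | no ¬q  = ⊥-elim (¬q (P⇒Q p))
... | no _  | yes _  = m≤n⇒m≤1+n (length-filter-mono P? Q? P⇒Q xs)
... | no _  | no _   = length-filter-mono P? Q? P⇒Q xs

length-filter-strictMono : ∀ {A : Set} {P Q : A → Set} (P? : Decidable P) (Q? : Decidable Q) →
                           (∀ {u} → P u → Q u) → ∀ xs {z} → z ∈ xs → Q z → ¬ P z →
                           length (filter P? xs) < length (filter Q? xs)
length-filter-strictMono P? Q? P⇒Q (x ∷ xs) (here refl) qz ¬pz with P? x | Q? x
... | yes p | _     = ⊥-elim (¬pz p)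
... | no _  | yes _ = s≤s (length-filter-mono P? Q? P⇒Q xs)
... | no _  | no ¬q = ⊥-elim (¬q qz)
length-filter-strictMono P? Q? P⇒Q (x ∷ xs) (there z∈) qz ¬pz with P? x | Q? x
... | yes _ | yes _ = s≤s (length-filter-strictMono P? Q? P⇒Q xs z∈ qz ¬pz)
... | yes p | no ¬q = ⊥-elim (¬q (P⇒Q p))
... | no _  | yes _ = m≤n⇒m≤1+n (length-filter-strictMono P? Q? P⇒Q xs z∈ qz ¬pz)
... | no _  | no _  = length-filter-strictMono P? Q? P⇒Q xs z∈ qz ¬pz

dominators : List Point → Point → List Point
dominators S z = filter (_≥P? z) S

dominators-shrink : ∀ S {u z} → u ∈ S → u ≥P z →
                    length (dominators S u) < length (dominators S z)
dominators-shrink S u∈ u>z =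
  length-filter-strictMono (_≥P? _) (_≥P? _) (λ v>u → ⊒-≥P-trans (≥P⇒⊒ v>u) u>z) S u∈ u>z ≥P-irrefl

-- Strict dominance is well founded on a finite set: each step upwards strictly
-- decreases the number of dominators.
maxP-dominates : ∀ S {z} → z ∈ S → Σ Point λ y → y ∈ maxP S × y ⊒ z
maxP-dominates S z∈ = go z∈ (<-wellFounded _)
  where
  go : ∀ {z} → z ∈ S → Acc _<_ (length (dominators S z)) → Σ Point λ y → y ∈ maxP S × y ⊒ z
  go {z} z∈ (acc rec) with any? (_≥P? z) S
  ... | no undominated = z , ∈-filter⁺ (undominated? S) z∈ undominated , ⊒-refl z
  ... | yes dominated with find dominated
  ... | u , u∈ , u>z with go u∈ (rec (dominators-shrink S u∈ u>z))
  ... | y , y∈ , y⊒u = y , y∈ , ⊒-trans y⊒u (≥P⇒⊒ u>z)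

pairwise : (Point → Point → Point) → List Point → List Point → List Point
pairwise _∙_ S T = concatMap (λ a → concatMap (λ b → a ∙ b ∷ []) T) S

∈-pairwise⁺ : ∀ (_∙_ : Point → Point → Point) {S T a b} → a ∈ S → b ∈ T → (a ∙ b) ∈ pairwise _∙_ S T
∈-pairwise⁺ _∙_ {S} {T} a∈ b∈ =
  ∈-concatMap⁺ _ {xs = S} (lose a∈ (∈-concatMap⁺ _ {xs = T} (lose b∈ (here refl))))

∈-pairwise⁻ : ∀ (_∙_ : Point → Point → Point) S T {y} → y ∈ pairwise _∙_ S T →
              Σ Point λ a → Σ Point λ b → a ∈ S × b ∈ T × y ≡ a ∙ b
∈-pairwise⁻ _∙_ S T y∈ with find (∈-concatMap⁻ _ {xs = S} y∈)
... | a , a∈ , y∈′ with find (∈-concatMap⁻ _ {xs = T} y∈′)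
... | b , b∈ , here y≡ = a , b , a∈ , b∈ , y≡

∈-unionOver⁺ : ∀ {x k y} (F : ℕ → List Point) → k ≤ x → y ∈ F k → y ∈ unionOver x F
∈-unionOver⁺ {x} F k≤x y∈ = ∈-concatMap⁺ _ {xs = upTo (suc x)} (lose (∈-upTo⁺ (s≤s k≤x)) y∈)

∈-unionOver⁻ : ∀ {x y} (F : ℕ → List Point) → y ∈ unionOver x F → Σ ℕ λ k → k ≤ x × y ∈ F k
∈-unionOver⁻ {x} F y∈ with find (∈-concatMap⁻ F {xs = upTo (suc x)} y∈)
... | k , k∈ , y∈′ = k , ≤-pred (∈-upTo⁻ k∈) , y∈′

-- pairwise _∧ᴾ_ and pairwise _+ᴾ_ unfold to ⊙ and ⊕, so this covers both composition steps.
module Recurrence (_∙_ : Point → Point → Point) (L₁ L₂ : ℕ → List Point) where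

  candidates : ℕ → ℕ → List Point
  candidates x k = pairwise _∙_ (L₁ k) (L₂ (x ∸ k))

  combined : ℕ → List Point
  combined x = maxP (unionOver x (candidates x))

  combined-antichain : ∀ x {y z} → y ∈ combined x → z ∈ combined x → ¬ (z ≥P y)
  combined-antichain x = maxP-antichain {S = unionOver x (candidates x)}

  combined-sound :
    ∀ {S₁ S₂ : Set} {cost₁ : S₁ → ℕ} {cost₂ : S₂ → ℕ} {val₁ : S₁ → Point} {val₂ : S₂ → Point} →
    (∀ k {y} → y ∈ L₁ k → Σ S₁ λ g → cost₁ g ≤ k × y ≡ val₁ g) →
    (∀ k {y} → y ∈ L₂ k → Σ S₂ λ g → cost₂ g ≤ k × y ≡ val₂ g) →
    ∀ x {y} → y ∈ combined x →
    Σ S₁ λ g₁ → Σ S₂ λ g₂ → cost₁ g₁ + cost₂ g₂ ≤ x × y ≡ val₁ g₁ ∙ val₂ g₂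
  combined-sound {cost₁ = cost₁} {cost₂} sound₁ sound₂ x y∈
    with ∈-unionOver⁻ (candidates x) (maxP⊆ y∈)
  ... | k , k≤x , y∈′ with ∈-pairwise⁻ _∙_ (L₁ k) (L₂ (x ∸ k)) y∈′
  ... | a , b , a∈ , b∈ , refl with sound₁ k a∈ | sound₂ (x ∸ k) b∈
  ... | g₁ , c₁ , refl | g₂ , c₂ , refl =
    g₁ , g₂ , subst (cost₁ g₁ + cost₂ g₂ ≤_) (m+[n∸m]≡n k≤x) (+-mono-≤ c₁ c₂) , refl

  combined-complete :
    ∀ {S₁ S₂ : Set} {cost₁ : S₁ → ℕ} {cost₂ : S₂ → ℕ} {val₁ : S₁ → Point} {val₂ : S₂ → Point} →
    (∀ {a a' b b'} → a' ⊒ a → b' ⊒ b → (a' ∙ b') ⊒ (a ∙ b)) → ∀ x →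
    (∀ k → k ≤ x → ∀ g → cost₁ g ≤ k → Σ Point λ y → y ∈ L₁ k × y ⊒ val₁ g) →
    (∀ k → k ≤ x → ∀ g → cost₂ g ≤ k → Σ Point λ y → y ∈ L₂ k × y ⊒ val₂ g) →
    ∀ g₁ g₂ → cost₁ g₁ + cost₂ g₂ ≤ x → Σ Point λ y → y ∈ combined x × y ⊒ (val₁ g₁ ∙ val₂ g₂)
  combined-complete {cost₁ = cost₁} {cost₂} ∙-mono x complete₁ complete₂ g₁ g₂ within =
    let a , a∈ , a⊒ = complete₁ (cost₁ g₁) c₁≤x g₁ ≤-refl
        b , b∈ , b⊒ = complete₂ (x ∸ cost₁ g₁) (m∸n≤m x (cost₁ g₁)) g₂ c₂≤rest
        y , y∈ , y⊒ = maxP-dominates (unionOver x (candidates x))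
                        (∈-unionOver⁺ (candidates x) c₁≤x (∈-pairwise⁺ _∙_ a∈ b∈))
    in y , y∈ , ⊒-trans y⊒ (∙-mono a⊒ b⊒)
    where
    c₁≤x : cost₁ g₁ ≤ x
    c₁≤x = m+n≤o⇒m≤o (cost₁ g₁) within
    c₂≤rest : cost₂ g₂ ≤ x ∸ cost₁ g₁
    c₂≤rest = m+n≤o⇒m≤o∸n (cost₂ g₂) (subst (_≤ x) (+-comm (cost₁ g₁) _) within)

Least : (ℕ → Set) → ℕ∞ → Set
Least P ∞ = ∀ n → ¬ P n
Least P (fin n) = P n × (∀ m → P m → n ≤ m)

Least-cong : ∀ {P Q : ℕ → Set} d → (∀ {n} → P n → Q n) → (∀ {n} → Q n → P n) →
             Least P d → Least Q d
Least-cong ∞ P⇒Q Q⇒P none n q = none n (Q⇒P q)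
Least-cong (fin n) P⇒Q Q⇒P (p , least) = P⇒Q p , λ m q → least m (Q⇒P q)

Least-unique : ∀ {P : ℕ → Set} d d' → Least P d → Least P d' → d ≡ d'
Least-unique ∞ ∞ _ _ = refl
Least-unique ∞ (fin n) none (p , _) = ⊥-elim (none n p)
Least-unique (fin n) ∞ (p , _) none = ⊥-elim (none n p)
Least-unique (fin n) (fin m) (p , n-least) (q , m-least) = cong fin (≤-antisym (n-least m q) (m-least n p))

Least-⊎ : ∀ {P₁ P₂ : ℕ → Set} d₁ d₂ → Least P₁ d₁ → Least P₂ d₂ →
          Least (λ n → P₁ n ⊎ P₂ n) (min∞ d₁ d₂)
Least-⊎ {P₁} {P₂} (fin a) (fin b) (pa , a-least) (pb , b-least) = attained , below
  where
  attained : P₁ (a ⊓ b) ⊎ P₂ (a ⊓ b)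
  attained with ⊓-sel a b
  ... | inj₁ a⊓b≡a = inj₁ (subst P₁ (sym a⊓b≡a) pa)
  ... | inj₂ a⊓b≡b = inj₂ (subst P₂ (sym a⊓b≡b) pb)
  below : ∀ m → P₁ m ⊎ P₂ m → a ⊓ b ≤ m
  below m (inj₁ p) = ≤-trans (m⊓n≤m a b) (a-least m p)
  below m (inj₂ p) = ≤-trans (m⊓n≤n a b) (b-least m p)
Least-⊎ (fin a) ∞ (pa , a-least) none = inj₁ pa , λ where
  m (inj₁ p) → a-least m p
  m (inj₂ p) → ⊥-elim (none m p)
Least-⊎ ∞ (fin b) none (pb , b-least) = inj₂ pb , λ where
  m (inj₁ p) → ⊥-elim (none m p)
  m (inj₂ p) → b-least m p
Least-⊎ ∞ ∞ none₁ none₂ n (inj₁ p) = none₁ n p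
Least-⊎ ∞ ∞ none₁ none₂ n (inj₂ p) = none₂ n p

SumOf : (ℕ → Set) → (ℕ → Set) → ℕ → Set
SumOf P₁ P₂ n = Σ ℕ λ n₁ → Σ ℕ λ n₂ → n ≡ n₁ + n₂ × P₁ n₁ × P₂ n₂

Least-SumOf : ∀ {P₁ P₂ : ℕ → Set} d₁ d₂ → Least P₁ d₁ → Least P₂ d₂ →
              Least (SumOf P₁ P₂) (d₁ +∞ d₂)
Least-SumOf (fin a) (fin b) (pa , a-least) (pb , b-least) = (a , b , refl , pa , pb) , λ where
  m (n₁ , n₂ , refl , p₁ , p₂) → +-mono-≤ (a-least n₁ p₁) (b-least n₂ p₂)
Least-SumOf (fin a) ∞ _ none n (n₁ , n₂ , _ , _ , p₂) = none n₂ p₂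
Least-SumOf ∞ d₂ none _ n (n₁ , n₂ , _ , p₁ , _) = none n₁ p₁

embP₁-injective : ∀ {T₁ T₂} {u v : Vert T₁} → embP₁ {T₁} {T₂} u ≡ embP₁ v → u ≡ v
embP₁-injective {u = src} {src} refl = refl
embP₁-injective {u = snk} {snk} refl = refl
embP₁-injective {u = inner i} {inner .i} refl = refl

embP₂-injective : ∀ {T₁ T₂} {u v : Vert T₂} → embP₂ {T₁} {T₂} u ≡ embP₂ v → u ≡ v
embP₂-injective {u = src} {src} refl = refl
embP₂-injective {u = snk} {snk} refl = refl
embP₂-injective {u = inner i} {inner .i} refl = refl

embS₁-injective : ∀ {T₁ T₂} {u v : Vert T₁} → embS₁ {T₁} {T₂} u ≡ embS₁ v → u ≡ v
embS₁-injective {u = src} {src} refl = refl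
embS₁-injective {u = snk} {snk} refl = refl
embS₁-injective {u = inner i} {inner .i} refl = refl

embS₂-injective : ∀ {T₁ T₂} {u v : Vert T₂} → embS₂ {T₁} {T₂} u ≡ embS₂ v → u ≡ v
embS₂-injective {u = src} {src} refl = refl
embS₂-injective {u = snk} {snk} refl = refl
embS₂-injective {u = inner i} {inner .i} refl = refl

embP₂≡embP₁ : ∀ {T₁ T₂} {u : Vert T₂} {v : Vert T₁} → embP₂ {T₁} {T₂} u ≡ embP₁ v →
              (u ≡ src × v ≡ src) ⊎ (u ≡ snk × v ≡ snk)
embP₂≡embP₁ {u = src} {src} refl = inj₁ (refl , refl)
embP₂≡embP₁ {u = snk} {snk} refl = inj₂ (refl , refl)
embP₂≡embP₁ {u = inner _} {src} ()
embP₂≡embP₁ {u = inner _} {snk} ()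
embP₂≡embP₁ {u = inner _} {inner _} ()

embS₁≡embS₂ : ∀ {T₁ T₂} {u : Vert T₁} {v : Vert T₂} → embS₁ {T₁} {T₂} u ≡ embS₂ v →
              u ≡ snk × v ≡ src
embS₁≡embS₂ {u = snk} {src} refl = refl , refl
embS₁≡embS₂ {u = src} {src} ()
embS₁≡embS₂ {u = src} {snk} ()
embS₁≡embS₂ {u = src} {inner _} ()
embS₁≡embS₂ {u = snk} {snk} ()
embS₁≡embS₂ {u = snk} {inner _} ()
embS₁≡embS₂ {u = inner _} {src} ()
embS₁≡embS₂ {u = inner _} {snk} ()
embS₁≡embS₂ {u = inner _} {inner _} ()

embS₁≢snk : ∀ {T₁ T₂} (u : Vert T₁) → ¬ (embS₁ {T₁} {T₂} u ≡ snk)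
embS₁≢snk src ()
embS₁≢snk snk ()
embS₁≢snk (inner _) ()

embS₂≢src : ∀ {T₁ T₂} (u : Vert T₂) → ¬ (embS₂ {T₁} {T₂} u ≡ src)
embS₂≢src src ()
embS₂≢src snk ()
embS₂≢src (inner _) ()

hd≢src : (T : SP) (a : Arc T) → ¬ (hd T a ≡ src)
hd≢src leaf a ()
hd≢src (par T₁ T₂) (inj₁ a) e = hd≢src T₁ a (embP₁-injective {v = src} e)
hd≢src (par T₁ T₂) (inj₂ a) e = hd≢src T₂ a (embP₂-injective {v = src} e)
hd≢src (ser T₁ T₂) (inj₁ a) e = hd≢src T₁ a (embS₁-injective {v = src} e)
hd≢src (ser T₁ T₂) (inj₂ a) e = embS₂≢src (hd T₂ a) e

tl≢snk : (T : SP) (a : Arc T) → ¬ (tl T a ≡ snk)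
tl≢snk leaf a ()
tl≢snk (par T₁ T₂) (inj₁ a) e = tl≢snk T₁ a (embP₁-injective {v = snk} e)
tl≢snk (par T₁ T₂) (inj₂ a) e = tl≢snk T₂ a (embP₂-injective {v = snk} e)
tl≢snk (ser T₁ T₂) (inj₁ a) e = embS₁≢snk (tl T₁ a) e
tl≢snk (ser T₁ T₂) (inj₂ a) e = tl≢snk T₂ a (embS₂-injective {v = snk} e)

_++ʷ_ : ∀ {T γ w u v z n m} → Walk T γ w u v n → Walk T γ w v z m → Walk T γ w u z (n + m)
stop ++ʷ W = W
_++ʷ_ {T} {γ} {w} {z = z} {m = m} (step {n = n} a free tl≡ W) W′ =
  subst (Walk T γ w _ z) (sym (+-assoc (w a) n m)) (step a free tl≡ (W ++ʷ W′))

module ParallelWalks {T₁ T₂ : SP} {γ : Strategy (par T₁ T₂)} {w : Arc (par T₁ T₂) → ℕ} where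
  private
    γ₁ = γ ∘ inj₁
    w₁ = w ∘ inj₁
    γ₂ = γ ∘ inj₂
    w₂ = w ∘ inj₂

  -- A walk that has left the common source can only reach the other part through the
  -- common sink, which has no outgoing arcs.
  stayˡ : ∀ {p q n} {u : Vert T₁} → Walk (par T₁ T₂) γ w p q n → p ≡ embP₁ u → ¬ (u ≡ src) →
          Σ (Vert T₁) λ v → q ≡ embP₁ v × Walk T₁ γ₁ w₁ u v n
  stayˡ {u = u} stop refl _ = u , refl , stop
  stayˡ (step (inj₁ a) free tl≡ W) refl _ with stayˡ W refl (hd≢src _ a)
  ... | v , q≡ , W₁ = v , q≡ , step a free (embP₁-injective tl≡) W₁
  stayˡ (step (inj₂ a) free tl≡ W) refl u≢src with embP₂≡embP₁ tl≡
  ... | inj₁ (_ , u≡src) = ⊥-elim (u≢src u≡src)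
  ... | inj₂ (tl≡snk , _) = ⊥-elim (tl≢snk T₂ a tl≡snk)

  stayʳ : ∀ {p q n} {u : Vert T₂} → Walk (par T₁ T₂) γ w p q n → p ≡ embP₂ u → ¬ (u ≡ src) →
          Σ (Vert T₂) λ v → q ≡ embP₂ v × Walk T₂ γ₂ w₂ u v n
  stayʳ {u = u} stop refl _ = u , refl , stop
  stayʳ (step (inj₂ a) free tl≡ W) refl _ with stayʳ W refl (hd≢src _ a)
  ... | v , q≡ , W₂ = v , q≡ , step a free (embP₂-injective tl≡) W₂
  stayʳ (step (inj₁ a) free tl≡ W) refl u≢src with embP₂≡embP₁ (sym tl≡)
  ... | inj₁ (u≡src , _) = ⊥-elim (u≢src u≡src)
  ... | inj₂ (_ , tl≡snk) = ⊥-elim (tl≢snk T₁ a tl≡snk)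

  split : ∀ {n} → Walk (par T₁ T₂) γ w src snk n →
          Walk T₁ γ₁ w₁ src snk n ⊎ Walk T₂ γ₂ w₂ src snk n
  split (step (inj₁ a) free tl≡ W) with stayˡ W refl (hd≢src T₁ a)
  ... | v , snk≡ , W₁ = inj₁ (step a free (embP₁-injective {v = src} tl≡)
          (subst (λ v → Walk T₁ γ₁ w₁ (hd T₁ a) v _) (sym (embP₁-injective {u = snk} snk≡)) W₁))
  split (step (inj₂ a) free tl≡ W) with stayʳ W refl (hd≢src T₂ a)
  ... | v , snk≡ , W₂ = inj₂ (step a free (embP₂-injective {v = src} tl≡)
          (subst (λ v → Walk T₂ γ₂ w₂ (hd T₂ a) v _) (sym (embP₂-injective {u = snk} snk≡)) W₂))

  embedˡ : ∀ {u v n} → Walk T₁ γ₁ w₁ u v n → Walk (par T₁ T₂) γ w (embP₁ u) (embP₁ v) n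
  embedˡ stop = stop
  embedˡ (step a free tl≡ W) = step (inj₁ a) free (cong embP₁ tl≡) (embedˡ W)

  embedʳ : ∀ {u v n} → Walk T₂ γ₂ w₂ u v n → Walk (par T₁ T₂) γ w (embP₂ u) (embP₂ v) n
  embedʳ stop = stop
  embedʳ (step a free tl≡ W) = step (inj₂ a) free (cong embP₂ tl≡) (embedʳ W)

  join : ∀ {n} → Walk T₁ γ₁ w₁ src snk n ⊎ Walk T₂ γ₂ w₂ src snk n →
         Walk (par T₁ T₂) γ w src snk n
  join (inj₁ W) = embedˡ W
  join (inj₂ W) = embedʳ W

module SeriesWalks {T₁ T₂ : SP} {γ : Strategy (ser T₁ T₂)} {w : Arc (ser T₁ T₂) → ℕ} where
  private
    γ₁ = γ ∘ inj₁
    w₁ = w ∘ inj₁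
    γ₂ = γ ∘ inj₂
    w₂ = w ∘ inj₂

  stayʳ : ∀ {p q n} {u : Vert T₂} → Walk (ser T₁ T₂) γ w p q n → p ≡ embS₂ u →
          Σ (Vert T₂) λ v → q ≡ embS₂ v × Walk T₂ γ₂ w₂ u v n
  stayʳ {u = u} stop refl = u , refl , stop
  stayʳ (step (inj₂ a) free tl≡ W) refl with stayʳ W refl
  ... | v , q≡ , W₂ = v , q≡ , step a free (embS₂-injective tl≡) W₂
  stayʳ (step (inj₁ a) free tl≡ W) refl = ⊥-elim (tl≢snk T₁ a (proj₁ (embS₁≡embS₂ tl≡)))

  splitFrom : ∀ {p q n} {u : Vert T₁} → Walk (ser T₁ T₂) γ w p q n → p ≡ embS₁ u → q ≡ snk →
              SumOf (Walk T₁ γ₁ w₁ u snk) (Walk T₂ γ₂ w₂ src snk) n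
  splitFrom {u = u} stop refl q≡snk = ⊥-elim (embS₁≢snk u q≡snk)
  splitFrom (step (inj₁ a) free tl≡ W) refl q≡snk with splitFrom W refl q≡snk
  ... | n₁ , n₂ , refl , W₁ , W₂ =
    w₁ a + n₁ , n₂ , sym (+-assoc (w₁ a) n₁ n₂) , step a free (embS₁-injective tl≡) W₁ , W₂
  splitFrom (step (inj₂ a) free tl≡ W) refl refl with embS₁≡embS₂ (sym tl≡) | stayʳ W refl
  ... | refl , tl≡src | v , snk≡ , W₂ = 0 , _ , refl , stop ,
    step a free tl≡src (subst (λ v → Walk T₂ γ₂ w₂ (hd T₂ a) v _) (sym (embS₂-injective {u = snk} snk≡)) W₂)

  split : ∀ {n} → Walk (ser T₁ T₂) γ w src snk n →
          SumOf (Walk T₁ γ₁ w₁ src snk) (Walk T₂ γ₂ w₂ src snk) n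
  split W = splitFrom {u = src} W refl refl

  embedˡ : ∀ {u v n} → Walk T₁ γ₁ w₁ u v n → Walk (ser T₁ T₂) γ w (embS₁ u) (embS₁ v) n
  embedˡ stop = stop
  embedˡ (step a free tl≡ W) = step (inj₁ a) free (cong embS₁ tl≡) (embedˡ W)

  embedʳ : ∀ {u v n} → Walk T₂ γ₂ w₂ u v n → Walk (ser T₁ T₂) γ w (embS₂ u) (embS₂ v) n
  embedʳ stop = stop
  embedʳ (step a free tl≡ W) = step (inj₂ a) free (cong embS₂ tl≡) (embedʳ W)

  join : ∀ {n} → SumOf (Walk T₁ γ₁ w₁ src snk) (Walk T₂ γ₂ w₂ src snk) n →
         Walk (ser T₁ T₂) γ w src snk n
  join (n₁ , n₂ , refl , W₁ , W₂) = embedˡ W₁ ++ʷ embedʳ W₂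

shortest : (T : SP) → Strategy T → (Arc T → ℕ) → ℕ∞
shortest leaf γ w with γ tt
... | true = ∞
... | false = fin (w tt)
shortest (par T₁ T₂) γ w = min∞ (shortest T₁ (γ ∘ inj₁) (w ∘ inj₁))
                                (shortest T₂ (γ ∘ inj₂) (w ∘ inj₂))
shortest (ser T₁ T₂) γ w = shortest T₁ (γ ∘ inj₁) (w ∘ inj₁)
                           +∞ shortest T₂ (γ ∘ inj₂) (w ∘ inj₂)

shortest-least : (T : SP) (γ : Strategy T) (w : Arc T → ℕ) →
                 Least (Walk T γ w src snk) (shortest T γ w)
shortest-least leaf γ w with γ tt in removed
... | true = λ { n (step tt free _ _) → true≢false (trans (sym removed) free) }
  where true≢false : ¬ (true ≡ false)
        true≢false ()
... | false = subst (Walk leaf γ w src snk) (+-identityʳ (w tt)) (step tt removed refl stop) ,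
              λ { m (step {n = k} tt _ _ _) → m≤m+n (w tt) k }
shortest-least (par T₁ T₂) γ w =
  Least-cong (shortest (par T₁ T₂) γ w) ParallelWalks.join ParallelWalks.split
    (Least-⊎ (shortest T₁ _ _) (shortest T₂ _ _) (shortest-least T₁ _ _) (shortest-least T₂ _ _))
shortest-least (ser T₁ T₂) γ w =
  Least-cong (shortest (ser T₁ T₂) γ w) SeriesWalks.join SeriesWalks.split
    (Least-SumOf (shortest T₁ _ _) (shortest T₂ _ _) (shortest-least T₁ _ _) (shortest-least T₂ _ _))

ShortestIs⇒Least : ∀ T γ w d → ShortestIs T γ w d → Least (Walk T γ w src snk) d
ShortestIs⇒Least T γ w ∞ h = h
ShortestIs⇒Least T γ w (fin n) h = h

Least⇒ShortestIs : ∀ T γ w d → Least (Walk T γ w src snk) d → ShortestIs T γ w d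
Least⇒ShortestIs T γ w ∞ h = h
Least⇒ShortestIs T γ w (fin n) h = h

objective : (T : SP) (l₁ l₂ : Arc T → ℕ) → Strategy T → Point
objective T l₁ l₂ γ = shortest T γ l₁ , shortest T γ l₂

ObjIs-objective : ∀ T l₁ l₂ γ → ObjIs T l₁ l₂ γ (objective T l₁ l₂ γ)
ObjIs-objective T l₁ l₂ γ =
  Least⇒ShortestIs T γ l₁ _ (shortest-least T γ l₁) , Least⇒ShortestIs T γ l₂ _ (shortest-least T γ l₂)

ObjIs⇒≡objective : ∀ T l₁ l₂ γ {y} → ObjIs T l₁ l₂ γ y → y ≡ objective T l₁ l₂ γ
ObjIs⇒≡objective T l₁ l₂ γ {y₁ , y₂} (h₁ , h₂) =
  cong₂ _,_ (Least-unique y₁ _ (ShortestIs⇒Least T γ l₁ y₁ h₁) (shortest-least T γ l₁))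
            (Least-unique y₂ _ (ShortestIs⇒Least T γ l₂ y₂ h₂) (shortest-least T γ l₂))

L-sound : ∀ T l₁ l₂ c B x {y} → y ∈ L T l₁ l₂ c B x →
          Σ (Strategy T) λ γ → cost T c γ ≤ x × y ≡ objective T l₁ l₂ γ
L-sound leaf l₁ l₂ c B x y∈ with c tt ≤? B
L-sound leaf l₁ l₂ c B x (here refl) | no _ = (λ _ → false) , z≤n , refl
L-sound leaf l₁ l₂ c B x y∈ | yes _ with x <? c tt
L-sound leaf l₁ l₂ c B x (here refl) | yes _ | yes _ = (λ _ → false) , z≤n , refl
L-sound leaf l₁ l₂ c B x (here refl) | yes _ | no x≮c = (λ _ → true) , ≮⇒≥ x≮c , refl
L-sound (par T₁ T₂) l₁ l₂ c B x y∈
  with Recurrence.combined-sound _∧ᴾ_ _ _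
         (L-sound T₁ (l₁ ∘ inj₁) (l₂ ∘ inj₁) (c ∘ inj₁) B)
         (L-sound T₂ (l₁ ∘ inj₂) (l₂ ∘ inj₂) (c ∘ inj₂) B) x y∈
... | γ₁ , γ₂ , within , refl = [ γ₁ , γ₂ ] , within , refl
L-sound (ser T₁ T₂) l₁ l₂ c B x y∈
  with Recurrence.combined-sound _+ᴾ_ _ _
         (L-sound T₁ (l₁ ∘ inj₁) (l₂ ∘ inj₁) (c ∘ inj₁) B)
         (L-sound T₂ (l₁ ∘ inj₂) (l₂ ∘ inj₂) (c ∘ inj₂) B) x y∈
... | γ₁ , γ₂ , within , refl = [ γ₁ , γ₂ ] , within , refl

-- Completeness needs x ≤ B: an arc with c(a) > B is never removed by the programme.
L-complete : ∀ T l₁ l₂ c B x → x ≤ B → ∀ γ → cost T c γ ≤ x →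
             Σ Point λ y → y ∈ L T l₁ l₂ c B x × y ⊒ objective T l₁ l₂ γ
L-complete leaf l₁ l₂ c B x x≤B γ within with γ tt
L-complete leaf l₁ l₂ c B x x≤B γ within | false with c tt ≤? B
... | no _ = _ , here refl , ⊒-refl _
... | yes _ with x <? c tt
...   | yes _ = _ , here refl , ⊒-refl _
...   | no _ = _ , here refl , (_ ≤∞∞) , (_ ≤∞∞)
L-complete leaf l₁ l₂ c B x x≤B γ within | true with c tt ≤? B
... | no c≰B = ⊥-elim (c≰B (≤-trans within x≤B))
... | yes _ with x <? c tt
...   | yes x<c = ⊥-elim (<⇒≱ x<c within)
...   | no _ = _ , here refl , (_ ≤∞∞) , (_ ≤∞∞)
L-complete (par T₁ T₂) l₁ l₂ c B x x≤B γ within =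
  Recurrence.combined-complete _∧ᴾ_ _ _ ∧ᴾ-mono x
    (λ k k≤x → L-complete T₁ (l₁ ∘ inj₁) (l₂ ∘ inj₁) (c ∘ inj₁) B k (≤-trans k≤x x≤B))
    (λ k k≤x → L-complete T₂ (l₁ ∘ inj₂) (l₂ ∘ inj₂) (c ∘ inj₂) B k (≤-trans k≤x x≤B))
    (γ ∘ inj₁) (γ ∘ inj₂) within
L-complete (ser T₁ T₂) l₁ l₂ c B x x≤B γ within =
  Recurrence.combined-complete _+ᴾ_ _ _ +ᴾ-mono x
    (λ k k≤x → L-complete T₁ (l₁ ∘ inj₁) (l₂ ∘ inj₁) (c ∘ inj₁) B k (≤-trans k≤x x≤B))
    (λ k k≤x → L-complete T₂ (l₁ ∘ inj₂) (l₂ ∘ inj₂) (c ∘ inj₂) B k (≤-trans k≤x x≤B))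
    (γ ∘ inj₁) (γ ∘ inj₂) within

L-antichain : ∀ T l₁ l₂ c B x {y z} → y ∈ L T l₁ l₂ c B x → z ∈ L T l₁ l₂ c B x → ¬ (z ≥P y)
L-antichain leaf l₁ l₂ c B x y∈ z∈ with c tt ≤? B
L-antichain leaf l₁ l₂ c B x (here refl) (here refl) | no _ = ≥P-irrefl
L-antichain leaf l₁ l₂ c B x y∈ z∈ | yes _ with x <? c tt
L-antichain leaf l₁ l₂ c B x (here refl) (here refl) | yes _ | yes _ = ≥P-irrefl
L-antichain leaf l₁ l₂ c B x (here refl) (here refl) | yes _ | no _ = ≥P-irrefl
L-antichain (par T₁ T₂) l₁ l₂ c B =
  Recurrence.combined-antichain _∧ᴾ_ (L T₁ (l₁ ∘ inj₁) (l₂ ∘ inj₁) (c ∘ inj₁) B)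
                                     (L T₂ (l₁ ∘ inj₂) (l₂ ∘ inj₂) (c ∘ inj₂) B)
L-antichain (ser T₁ T₂) l₁ l₂ c B =
  Recurrence.combined-antichain _+ᴾ_ (L T₁ (l₁ ∘ inj₁) (l₂ ∘ inj₁) (c ∘ inj₁) B)
                                     (L T₂ (l₁ ∘ inj₂) (l₂ ∘ inj₂) (c ∘ inj₂) B)

L⊆Z_N : ∀ T l₁ l₂ c B {y} → y ∈ L T l₁ l₂ c B B → InZN T l₁ l₂ c B y
L⊆Z_N T l₁ l₂ c B y∈ with L-sound T l₁ l₂ c B B y∈
... | γ , feasible , y≡ =
  γ , feasible , efficient , subst (ObjIs T l₁ l₂ γ) (sym y≡) (ObjIs-objective T l₁ l₂ γ)
  where
  efficient : Efficient T l₁ l₂ c B γ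
  efficient γ′ feasible′ y₀ y′ obj obj′ y′>y₀ =
    let z , z∈ , z⊒ = L-complete T l₁ l₂ c B B ≤-refl γ′ feasible′
        y₀≡y = trans (ObjIs⇒≡objective T l₁ l₂ γ obj) (sym y≡)
    in L-antichain T l₁ l₂ c B B y∈ z∈
         (⊒-≥P-trans z⊒ (subst₂ _≥P_ (ObjIs⇒≡objective T l₁ l₂ γ′ obj′) y₀≡y y′>y₀))

Z_N⊆L : ∀ T l₁ l₂ c B {y} → InZN T l₁ l₂ c B y → y ∈ L T l₁ l₂ c B B
Z_N⊆L T l₁ l₂ c B (γ , feasible , efficient , obj) with ObjIs⇒≡objective T l₁ l₂ γ obj
... | refl with L-complete T l₁ l₂ c B B ≤-refl γ feasible
... | z , z∈ , z⊒ with z ≟P objective T l₁ l₂ γ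
... | yes refl = z∈
... | no z≢ with L-sound T l₁ l₂ c B B z∈
... | γ′ , feasible′ , refl =
  ⊥-elim (efficient γ′ feasible′ _ _ obj (ObjIs-objective T l₁ l₂ γ′) (proj₁ z⊒ , proj₂ z⊒ , z≢))

theorem3 : (T : SP) (l₁ l₂ c : Arc T → ℕ) (B : ℕ) (y : Point) →
    (y ∈ L T l₁ l₂ c B B) ⇔ InZN T l₁ l₂ c B y
theorem3 T l₁ l₂ c B y = mk⇔ (L⊆Z_N T l₁ l₂ c B) (Z_N⊆L T l₁ l₂ c B)
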